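{- Let $n,k$ be positive integers with $n\ge 2k$ and $\gcd(n,k)=1$, and let $X,Y$ be distinct vertices of $Q(n,k)$ that are not adjacent, i.e. $X\cap Y\neq\emptyset$. Let $t\in\{1,\dots,n-1\}$ be the unique integer with $\rho^t(X)=Y$. Then the number $|Y\cap\{i+1,i+2,\dots,i+t\}|$ (addition mod $n$) of elements of $Y$ on the clockwise arc from $i$ to $\rho^t(i)$, excluding $i$ and including $\rho^t(i)$, is the same for every choice of $i\in X\cap Y$.
   Context: For a positive integer $n$ let $[n]=\{1,\dots,n\}$ and let $C_n$ be the cycle on $[n]$ with edges $\{i,i+1\}$ ($1\le i\le n-1$) and $\{n,1\}$. The Schrijver graph $\mathrm{SG}(n,k)$ ($n\ge 2k$) has as vertices the $k$-subsets of $[n]$ containing no two cyclically consecutive elements, two vertices adjacent iff they are disjoint. An arc of $C_n$ is a set $\{i,i+1,\dots,i+m-1\}$ (addition mod $n$) with $1\le m\le n-1$. A set $U\subseteq[n]$ is well-spread if for any two arcs $A,B$ with $|A|=|B|$ we have $\big||A\cap U|-|B\cap U|\big|\le 1$. $Q(n,k)$ is the induced subgraph of $\mathrm{SG}(n,k)$ on all well-spread $k$-subsets of $[n]$. $\rho:[n]\to[n]$ is the rotation $i\mapsto i+1$ (mod $n$), acting on subsets elementwise; for $\gcd(n,k)=1$ every vertex of $Q(n,k)$ is mapped to every other by exactly one power $\rho^t$, $0\le t\le n-1$. -}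

module Defs where

open import Data.Nat using (ℕ; zero; suc; _+_; _∸_; _≤_; _<_; ∣_-_∣)
open import Data.Nat.DivMod using (_mod_)
open import Data.Fin using (Fin; toℕ)
open import Data.Fin.Subset using (Subset; ⊥; _∪_; _∩_; ⁅_⁆; _∈_; _∉_; ∣_∣)
open import Data.Product using (_×_; ∃-syntax)
open import Function.Bundles using (_⇔_)
open import Relation.Binary.PropositionalEquality using (_≡_)

-- Points of the cycle C_n are represented by Fin n = {0,…,n-1}
-- (point p ∈ Fin n corresponds to p+1 ∈ [n]).  Subsets of [n] are Subset n.

addMod : ∀ {n} → Fin n → ℕ → Fin n
addMod {suc n} i m = (toℕ i + m) mod (suc n)

arc : ∀ {n} → Fin n → ℕ → Subset n
arc i zero    = ⊥
arc i (suc m) = arc i m ∪ ⁅ addMod i m ⁆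

WellSpread : ∀ {n} → Subset n → Set
WellSpread {n} U =
  ∀ (i j : Fin n) (m : ℕ) → 1 ≤ m → m ≤ n ∸ 1 →
  ∣ ∣ arc i m ∩ U ∣ - ∣ arc j m ∩ U ∣ ∣ ≤ 1

Stable : ∀ {n} → Subset n → Set
Stable {n} X = ∀ (i : Fin n) → i ∈ X → addMod i 1 ∉ X

IsSGVertex : (n k : ℕ) → Subset n → Set
IsSGVertex n k X = ∣ X ∣ ≡ k × Stable X

IsQVertex : (n k : ℕ) → Subset n → Set
IsQVertex n k X = IsSGVertex n k X × WellSpread X

IsRot : ∀ {n} → ℕ → Subset n → Subset n → Set
IsRot {n} t X Y = ∀ (y : Fin n) → (y ∈ Y ⇔ (∃[ x ] (x ∈ X × addMod x t ≡ y)))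

{-# OPTIONS --safe #-}
-- For i ∈ Y let f(i) be the number of points of Y in the arc (i, i+t].  The arc
-- [i, i+t] of length t+1 contains f(i)+1 points of Y, since it also contains i.
-- If j ∈ X then j+t ∈ Y, so by stability j+t+1 ∉ Y and the arc (j, j+t+1] of
-- length t+1 contains only f(j) points of Y.  Well-spreadness of Y compares the
-- two arcs: f(i)+1 ≤ f(j)+1, and exchanging i and j gives equality.  The arcs
-- are proper (t+1 < n) because t = n-1 would put both j-1 and j in Y.
module Submission where

open import Defs
open import Data.Nat using (ℕ; zero; suc; _+_; _*_; _≤_; _<_; z≤n; s≤s; s≤s⁻¹; ∣_-_∣)
open import Data.Nat.Properties
open import Data.Nat.DivMod using (_%_; _/_; m%n<n; m<n⇒m%n≡m; m≡m%n+[m/n]*n; %-distribˡ-+; m%n%n≡m%n; [m+n]%n≡m%n)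
open import Data.Nat.GCD using (gcd)
open import Data.Fin using (Fin; toℕ)
open import Data.Fin.Properties using (toℕ-injective; toℕ-fromℕ<; toℕ<n)
open import Data.Fin.Subset using (Subset; _∈_; _∉_; _⊆_; _∩_; ⁅_⁆; ∣_∣)
open import Data.Fin.Subset.Properties using (x∈p∩q⁺; x∈p∩q⁻; x∈p∪q⁺; x∈p∪q⁻; x∈⁅x⁆; x∈⁅y⁆⇒x≡y; ∉⊥; p⊆q⇒∣p∣≤∣q∣; p⊂q⇒∣p∣<∣q∣)
open import Data.Product using (_×_; _,_; proj₂; ∃-syntax)
open import Data.Sum using (inj₁; inj₂)
open import Data.Empty using (⊥-elim)
open import Function.Bundles using (Equivalence)
open import Relation.Nullary using (yes; no)
open import Relation.Binary.PropositionalEquality using (_≡_; _≢_; refl; sym; trans; cong; subst; module ≡-Reasoning)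

toℕ-addMod : ∀ {n} (a : Fin (suc n)) b → toℕ (addMod a b) ≡ (toℕ a + b) % suc n
toℕ-addMod {n} a b = toℕ-fromℕ< (m%n<n (toℕ a + b) (suc n))

addMod-+ : ∀ {n} (a : Fin (suc n)) b c → addMod (addMod a b) c ≡ addMod a (b + c)
addMod-+ {n} a b c = toℕ-injective (begin
  toℕ (addMod (addMod a b) c)           ≡⟨ toℕ-addMod (addMod a b) c ⟩
  (toℕ (addMod a b) + c) % N            ≡⟨ cong (λ v → (v + c) % N) (toℕ-addMod a b) ⟩
  ((toℕ a + b) % N + c) % N             ≡⟨ %-distribˡ-+ ((toℕ a + b) % N) c N ⟩
  ((toℕ a + b) % N % N + c % N) % N     ≡⟨ cong (λ v → (v + c % N) % N) (m%n%n≡m%n (toℕ a + b) N) ⟩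
  ((toℕ a + b) % N + c % N) % N         ≡⟨ %-distribˡ-+ (toℕ a + b) c N ⟨
  (toℕ a + b + c) % N                   ≡⟨ cong (_% N) (+-assoc (toℕ a) b c) ⟩
  (toℕ a + (b + c)) % N                 ≡⟨ toℕ-addMod a (b + c) ⟨
  toℕ (addMod a (b + c))                ∎)
  where
  open ≡-Reasoning
  N = suc n

addMod-zero : ∀ {n} (a : Fin (suc n)) → addMod a 0 ≡ a
addMod-zero {n} a = toℕ-injective (begin
  toℕ (addMod a 0)       ≡⟨ toℕ-addMod a 0 ⟩
  (toℕ a + 0) % suc n    ≡⟨ cong (_% suc n) (+-identityʳ (toℕ a)) ⟩
  toℕ a % suc n          ≡⟨ m<n⇒m%n≡m (toℕ<n a) ⟩
  toℕ a                  ∎)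
  where open ≡-Reasoning

addMod-period : ∀ {n} (a : Fin (suc n)) → addMod a (suc n) ≡ a
addMod-period {n} a = toℕ-injective (begin
  toℕ (addMod a (suc n))     ≡⟨ toℕ-addMod a (suc n) ⟩
  (toℕ a + suc n) % suc n    ≡⟨ [m+n]%n≡m%n (toℕ a) (suc n) ⟩
  toℕ a % suc n              ≡⟨ m<n⇒m%n≡m (toℕ<n a) ⟩
  toℕ a                      ∎)
  where open ≡-Reasoning

-- a + s ≡ a (mod N) forces s = q N, where q is the quotient of a + s by N.
addMod-≢ : ∀ {n} (a : Fin (suc n)) {s} → 0 < s → s < suc n → addMod a s ≢ a
addMod-≢ {n} a {s} 0<s s<N eq with (toℕ a + s) / suc n | s≡q*N
  where
  open ≡-Reasoning
  q = (toℕ a + s) / suc n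
  s≡q*N : s ≡ q * suc n
  s≡q*N = +-cancelˡ-≡ (toℕ a) s (q * suc n) (begin
    toℕ a + s                        ≡⟨ m≡m%n+[m/n]*n (toℕ a + s) (suc n) ⟩
    (toℕ a + s) % suc n + q * suc n  ≡⟨ cong (_+ q * suc n) (trans (sym (toℕ-addMod a s)) (cong toℕ eq)) ⟩
    toℕ a + q * suc n                ∎)
... | zero  | s≡0 = <-irrefl (sym s≡0) 0<s
... | suc _ | s≡N+ = <-irrefl refl (<-≤-trans s<N (subst (suc n ≤_) (sym s≡N+) (m≤m+n (suc n) _)))

addMod∈arc : ∀ {n} (a : Fin n) {l m} → l < m → addMod a l ∈ arc a m
addMod∈arc a {l} {suc m} l<1+m with l ≟ m
... | yes refl = x∈p∪q⁺ (inj₂ (x∈⁅x⁆ (addMod a l)))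
... | no l≢m   = x∈p∪q⁺ (inj₁ (addMod∈arc a (≤∧≢⇒< (s≤s⁻¹ l<1+m) l≢m)))

∈arc⇒addMod : ∀ {n} (a : Fin n) m {x} → x ∈ arc a m → ∃[ l ] (l < m × x ≡ addMod a l)
∈arc⇒addMod a zero x∈ = ⊥-elim (∉⊥ x∈)
∈arc⇒addMod a (suc m) x∈ with x∈p∪q⁻ (arc a m) ⁅ addMod a m ⁆ x∈
... | inj₁ x∈arc = let (l , l<m , x≡) = ∈arc⇒addMod a m x∈arc in l , m≤n⇒m≤1+n l<m , x≡
... | inj₂ x∈⁅⁆   = m , ≤-refl , x∈⁅y⁆⇒x≡y (addMod a m) x∈⁅⁆

arc-start∈ : ∀ {n} (a : Fin (suc n)) m → a ∈ arc a (suc m)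
arc-start∈ a m = subst (_∈ arc a (suc m)) (addMod-zero a) (addMod∈arc a (s≤s z≤n))

arc-tail⊆ : ∀ {n} (a : Fin (suc n)) m → arc (addMod a 1) m ⊆ arc a (suc m)
arc-tail⊆ a m x∈ with ∈arc⇒addMod (addMod a 1) m x∈
... | l , l<m , refl = subst (_∈ arc a (suc m)) (sym (addMod-+ a 1 l)) (addMod∈arc a (s≤s l<m))

arc-tail∌start : ∀ {n} (a : Fin (suc n)) {m} → m < suc n → a ∉ arc (addMod a 1) m
arc-tail∌start a {m} m<N a∈ with ∈arc⇒addMod (addMod a 1) m a∈
... | l , l<m , a≡ = addMod-≢ a (s≤s z≤n) (≤-<-trans l<m m<N) (sym (trans a≡ (addMod-+ a 1 l)))

stable-pred∉ : ∀ {n} {Y : Subset (suc n)} → Stable Y → ∀ {j} → j ∈ Y → addMod j n ∉ Y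
stable-pred∉ {n} stY {j} j∈Y j-1∈Y = stY (addMod j n) j-1∈Y (subst (_∈ _) (sym j-1+1≡j) j∈Y)
  where
  j-1+1≡j : addMod (addMod j n) 1 ≡ j
  j-1+1≡j = trans (addMod-+ j n 1) (trans (cong (addMod j) (+-comm n 1)) (addMod-period j))

∈⇒∣∩arc-tail∣<∣arc∩∣ : ∀ {n} {Y : Subset (suc n)} {i} → i ∈ Y → ∀ {t} → t < suc n →
                     ∣ Y ∩ arc (addMod i 1) t ∣ < ∣ arc i (suc t) ∩ Y ∣
∈⇒∣∩arc-tail∣<∣arc∩∣ {Y = Y} {i} i∈Y {t} t<N = p⊂q⇒∣p∣<∣q∣ (⊆ , i , i∈ , i∉)
  where
  ⊆ : Y ∩ arc (addMod i 1) t ⊆ arc i (suc t) ∩ Y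
  ⊆ x∈ = let (x∈Y , x∈arc) = x∈p∩q⁻ Y _ x∈ in x∈p∩q⁺ (arc-tail⊆ i t x∈arc , x∈Y)
  i∈ : i ∈ arc i (suc t) ∩ Y
  i∈ = x∈p∩q⁺ (arc-start∈ i t , i∈Y)
  i∉ : i ∉ Y ∩ arc (addMod i 1) t
  i∉ i∈′ = arc-tail∌start i t<N (proj₂ (x∈p∩q⁻ Y _ i∈′))

end∉⇒∣arc∩∣≤∣∩arc∣ : ∀ {n} {Y : Subset n} (a : Fin n) m → addMod a m ∉ Y →
                   ∣ arc a (suc m) ∩ Y ∣ ≤ ∣ Y ∩ arc a m ∣
end∉⇒∣arc∩∣≤∣∩arc∣ {Y = Y} a m end∉Y = p⊆q⇒∣p∣≤∣q∣ ⊆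
  where
  ⊆ : arc a (suc m) ∩ Y ⊆ Y ∩ arc a m
  ⊆ {x} x∈ with x∈p∩q⁻ (arc a (suc m)) Y x∈
  ... | x∈arc , x∈Y with x∈p∪q⁻ (arc a m) ⁅ addMod a m ⁆ x∈arc
  ...   | inj₁ x∈arc′ = x∈p∩q⁺ (x∈Y , x∈arc′)
  ...   | inj₂ x∈⁅⁆   = ⊥-elim (end∉Y (subst (_∈ Y) (x∈⁅y⁆⇒x≡y _ x∈⁅⁆) x∈Y))

arc-count-≤ : ∀ {n} {Y : Subset (suc n)} → Stable Y → WellSpread Y →
              ∀ {t} → t < suc n → ∀ {i j} → i ∈ Y → j ∈ Y → addMod j t ∈ Y →
              ∣ Y ∩ arc (addMod i 1) t ∣ ≤ ∣ Y ∩ arc (addMod j 1) t ∣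
arc-count-≤ {n} {Y} stY wsY {t} t<N {i} {j} i∈Y j∈Y j+t∈Y with m≤n⇒m<n∨m≡n (s≤s⁻¹ t<N)
... | inj₂ refl = ⊥-elim (stable-pred∉ stY j∈Y j+t∈Y)
... | inj₁ t<n  = s≤s⁻¹ (begin
  suc ∣ Y ∩ arc (addMod i 1) t ∣          ≤⟨ ∈⇒∣∩arc-tail∣<∣arc∩∣ i∈Y t<N ⟩
  A                                       ≤⟨ m≤n+∣m-n∣ A B ⟩
  B + ∣ A - B ∣                           ≤⟨ +-monoʳ-≤ B (wsY i (addMod j 1) (suc t) (s≤s z≤n) t<n) ⟩
  B + 1                                   ≤⟨ +-monoˡ-≤ 1 (end∉⇒∣arc∩∣≤∣∩arc∣ (addMod j 1) t j+1+t∉Y) ⟩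
  ∣ Y ∩ arc (addMod j 1) t ∣ + 1          ≡⟨ +-comm _ 1 ⟩
  suc ∣ Y ∩ arc (addMod j 1) t ∣          ∎)
  where
  open ≤-Reasoning
  A = ∣ arc i (suc t) ∩ Y ∣
  B = ∣ arc (addMod j 1) (suc t) ∩ Y ∣
  j+1+t∉Y : addMod (addMod j 1) t ∉ Y
  j+1+t∉Y = subst (_∉ Y) (trans (addMod-+ j t 1) (trans (cong (addMod j) (+-comm t 1)) (sym (addMod-+ j 1 t))))
                  (stY (addMod j t) j+t∈Y)

rot-image∈ : ∀ {n t} {X Y : Subset n} → IsRot t X Y → ∀ {x} → x ∈ X → addMod x t ∈ Y
rot-image∈ rot {x} x∈X = Equivalence.from (rot (addMod x _)) (x , x∈X , refl)

lemma13 : (n k : ℕ) → 1 ≤ k → 2 * k ≤ n → gcd n k ≡ 1 →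
          (X Y : Subset n) → IsQVertex n k X → IsQVertex n k Y →
          X ≢ Y → (∃[ z ] (z ∈ X ∩ Y)) →
          (t : ℕ) → 1 ≤ t → t < n → IsRot t X Y →
          (i j : Fin n) → i ∈ X ∩ Y → j ∈ X ∩ Y →
          ∣ Y ∩ arc (addMod i 1) t ∣ ≡ ∣ Y ∩ arc (addMod j 1) t ∣
lemma13 (suc n) k _ _ _ X Y _ ((_ , stY) , wsY) _ _ t _ t<n rot i j i∈X∩Y j∈X∩Y =
  ≤-antisym (count-≤ i∈X∩Y j∈X∩Y) (count-≤ j∈X∩Y i∈X∩Y)
  where
  count-≤ : ∀ {a b} → a ∈ X ∩ Y → b ∈ X ∩ Y → ∣ Y ∩ arc (addMod a 1) t ∣ ≤ ∣ Y ∩ arc (addMod b 1) t ∣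
  count-≤ a∈ b∈ = let (b∈X , b∈Y) = x∈p∩q⁻ X Y b∈ in
    arc-count-≤ stY wsY t<n (proj₂ (x∈p∩q⁻ X Y a∈)) b∈Y (rot-image∈ rot b∈X)
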